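{- Let $G=A+B$ be a finite bipartite graph, let $g\colon B\to\mathbb N$ be a need function, and let $F$ be a $g$-quasi-matching of $B$. Let $X\subseteq A$ with $|X|=k\ge 1$, and let $Y=N(X)$. Let $t$ be the number of edges of $G$ with one end-vertex in $Y$ and the other in $A\setminus X$, and write $g(Y)=t+dk+r$ with integers $d\ge 0$ and $0\le r<k$. Then $d_F(X)$ is lexicographically greater than or equal to the nonincreasing sequence consisting of $r$ entries equal to $d+1$ followed by $k-r$ entries equal to $d$.
   Context: $G=A+B$ denotes a bipartite graph with bipartition $(A,B)$; $N(Y)$ is the set of vertices adjacent to some vertex of $Y$. For a need function $g\colon B\to\mathbb N$ and $Y\subseteq B$, $g(Y)=\sum_{v\in Y}g(v)$. A set $F\subseteq E(G)$ is a $g$-quasi-matching of $Y\subseteq B$ if every $v\in Y$ is incident with at least $g(v)$ edges of $F$. For a vertex $v$, $d_F(v)$ is the number of edges of $F$ incident with $v$. For $X\subseteq A$, $d_F(X)$ denotes the sequence of the values $d_F(x)$, $x\in X$, listed in nonincreasing order. -}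

module Defs where

open import Data.Bool using (Bool; true; false; _∧_; not)
open import Data.Nat using (ℕ; _+_; suc; _≤_)
open import Data.Nat.Properties using (≤-decTotalOrder)
open import Data.Fin using (Fin)
open import Data.List using (List; filterᵇ; length; map; reverse; replicate; _++_)
open import Data.Nat.ListAction using (sum)
open import Data.Bool.ListAction using (any)
open import Relation.Binary.PropositionalEquality using (_≡_)
open import Data.List.Base using (allFin)
open import Data.List.Sort ≤-decTotalOrder using (sort)

-- A finite bipartite graph G = A + B with A = Fin m, B = Fin n,
-- given by its (decidable) adjacency  E a b = true  iff  ab ∈ E(G).
BipGraph : ℕ → ℕ → Set
BipGraph m n = Fin m → Fin n → Bool

_⊆ᴱ_ : ∀ {m n} → BipGraph m n → BipGraph m n → Set
F ⊆ᴱ E = ∀ a b → F a b ≡ true → E a b ≡ true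

elems : ∀ {k} → (Fin k → Bool) → List (Fin k)
elems S = filterᵇ S (allFin _)

card : ∀ {k} → (Fin k → Bool) → ℕ
card S = length (elems S)

degA : ∀ {m n} → BipGraph m n → Fin m → ℕ
degA F a = card (F a)

degB : ∀ {m n} → BipGraph m n → Fin n → ℕ
degB F b = card (λ a → F a b)

gSum : ∀ {n} → (Fin n → ℕ) → (Fin n → Bool) → ℕ
gSum g Y = sum (map g (elems Y))

IsQuasiMatching : ∀ {m n} → (Fin n → ℕ) → BipGraph m n → (Fin n → Bool) → Set
IsQuasiMatching g F Y = ∀ b → Y b ≡ true → g b ≤ degB F b

nbhd : ∀ {m n} → BipGraph m n → (Fin m → Bool) → Fin n → Bool
nbhd E X b = any (λ a → X a ∧ E a b) (allFin _)

crossEdges : ∀ {m n} → BipGraph m n → (Fin m → Bool) → (Fin n → Bool) → ℕ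
crossEdges E X Y = sum (map (λ b → card (λ a → not (X a) ∧ E a b)) (elems Y))

degSeq : ∀ {m n} → BipGraph m n → (Fin m → Bool) → List ℕ
degSeq F X = reverse (sort (map (degA F) (elems X)))

-- r entries equal to d+1 followed by k−r entries equal to d   (here kr = k − r)
targetSeq : ℕ → ℕ → ℕ → List ℕ
targetSeq d r kr = replicate r (suc d) ++ replicate kr d

module Submission where

-- Double counting the edges of F at the vertices of Y ⊆ B:
-- each b ∈ Y has g(b) ≤ d_F(b), and an F-edge at b goes either to X or to
-- A ∖ X; the latter are edges of G between Y and A ∖ X.  Hence
--     g(Y) ≤ t + Σ_{x ∈ X} d_F(x)          (for every Y ⊆ B),
-- so with g(Y) = t + dk + r the degrees of X sum to at least dk + r.
-- The theorem is then a statement about sequences alone: a nonincreasing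
-- sequence of k naturals with sum ≥ dk + r is lexicographically at least
-- (d+1)^r d^(k−r).  Compare heads: a larger head settles the comparison,
-- an equal head lets us recurse on the tails, and a smaller head bounds
-- the whole sum by k·head, which is too small.

open import Defs
open import Data.Bool using (Bool; true; false; _∧_; not; if_then_else_)
open import Data.Nat using (ℕ; zero; suc; _+_; _*_; _∸_; _≤_; _<_; z≤n; s≤s)
open import Data.Nat.Properties
open import Data.Nat.ListAction using (sum)
open import Data.Nat.ListAction.Properties using (sum-↭)
open import Data.Nat.Tactic.RingSolver using (solve-∀)
open import Data.Fin using (Fin)
open import Data.List using (List; []; _∷_; map; length; filterᵇ; reverse)
open import Data.List.Base using (allFin)
open import Data.List.Properties using (unfold-reverse; length-map)
open import Data.List.Relation.Unary.All using (All; []; _∷_) renaming (map to All-map)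
open import Data.List.Relation.Unary.AllPairs using (AllPairs; []; _∷_)
import Data.List.Relation.Unary.AllPairs.Properties as AllPairs
open import Data.List.Relation.Unary.Linked.Properties using (Linked⇒AllPairs)
open import Data.List.Relation.Binary.Permutation.Propositional using (_↭_; ↭-sym; ↭-trans)
open import Data.List.Relation.Binary.Permutation.Propositional.Properties
  using (↭-length; ↭-reverse; All-resp-↭)
open import Data.List.Relation.Binary.Lex.NonStrict using (Lex-≤)
open import Data.List.Relation.Binary.Lex.Core using (base; this; next)
open import Data.List.Sort ≤-decTotalOrder using (sort; sort-↭; sort-↗)
open import Algebra.Properties.CommutativeSemigroup +-commutativeSemigroup using (interchange)
open import Data.Product using (_,_)
open import Data.Unit using (tt)
open import Data.Empty using (⊥; ⊥-elim)
open import Relation.Binary.Definitions using (tri<; tri≈; tri>)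
open import Relation.Binary.PropositionalEquality using (_≡_; refl; sym; trans; cong; cong₂; module ≡-Reasoning)

indicator : Bool → ℕ
indicator true  = 1
indicator false = 0

module _ {A : Set} where

  length-filterᵇ : (S : A → Bool) (xs : List A) →
    length (filterᵇ S xs) ≡ sum (map (λ x → indicator (S x)) xs)
  length-filterᵇ S [] = refl
  length-filterᵇ S (x ∷ xs) with S x
  ... | true  = cong suc (length-filterᵇ S xs)
  ... | false = length-filterᵇ S xs

  sum-filterᵇ : (f : A → ℕ) (S : A → Bool) (xs : List A) →
    sum (map f (filterᵇ S xs)) ≡ sum (map (λ x → if S x then f x else 0) xs)
  sum-filterᵇ f S [] = refl
  sum-filterᵇ f S (x ∷ xs) with S x
  ... | true  = cong (f x +_) (sum-filterᵇ f S xs)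
  ... | false = sum-filterᵇ f S xs

  sum-filterᵇ-≤ : (f : A → ℕ) (S : A → Bool) (xs : List A) →
    sum (map f (filterᵇ S xs)) ≤ sum (map f xs)
  sum-filterᵇ-≤ f S [] = z≤n
  sum-filterᵇ-≤ f S (x ∷ xs) with S x
  ... | true  = +-monoʳ-≤ (f x) (sum-filterᵇ-≤ f S xs)
  ... | false = ≤-trans (sum-filterᵇ-≤ f S xs) (m≤n+m _ (f x))

  sum-mono : (f h : A → ℕ) → (∀ x → f x ≤ h x) → (xs : List A) →
    sum (map f xs) ≤ sum (map h xs)
  sum-mono f h f≤h [] = z≤n
  sum-mono f h f≤h (x ∷ xs) = +-mono-≤ (f≤h x) (sum-mono f h f≤h xs)

  sum-filterᵇ-mono : (f h : A → ℕ) (S : A → Bool) → (∀ x → S x ≡ true → f x ≤ h x) →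
    (xs : List A) → sum (map f (filterᵇ S xs)) ≤ sum (map h (filterᵇ S xs))
  sum-filterᵇ-mono f h S f≤h [] = z≤n
  sum-filterᵇ-mono f h S f≤h (x ∷ xs) with S x in x∈S
  ... | true  = +-mono-≤ (f≤h x x∈S) (sum-filterᵇ-mono f h S f≤h xs)
  ... | false = sum-filterᵇ-mono f h S f≤h xs

  sum-cong : (f h : A → ℕ) → (∀ x → f x ≡ h x) → (xs : List A) →
    sum (map f xs) ≡ sum (map h xs)
  sum-cong f h f≡h [] = refl
  sum-cong f h f≡h (x ∷ xs) = cong₂ _+_ (f≡h x) (sum-cong f h f≡h xs)

  sum-zero : (xs : List A) → sum (map (λ _ → 0) xs) ≡ 0
  sum-zero [] = refl
  sum-zero (x ∷ xs) = sum-zero xs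

  sum-+ : (f h : A → ℕ) (xs : List A) →
    sum (map (λ x → f x + h x) xs) ≡ sum (map f xs) + sum (map h xs)
  sum-+ f h [] = refl
  sum-+ f h (x ∷ xs) =
    trans (cong (f x + h x +_) (sum-+ f h xs))
          (interchange (f x) (h x) (sum (map f xs)) (sum (map h xs)))

sum-swap : {A B : Set} (h : A → B → ℕ) (xs : List A) (ys : List B) →
  sum (map (λ a → sum (map (h a) ys)) xs) ≡ sum (map (λ b → sum (map (λ a → h a b) xs)) ys)
sum-swap h [] ys = sym (sum-zero ys)
sum-swap h (x ∷ xs) ys =
  trans (cong (sum (map (h x) ys) +_) (sum-swap h xs ys))
        (sym (sum-+ (h x) (λ b → sum (map (λ a → h a b) xs)) ys))

module DoubleCounting {m n : ℕ} (E F : BipGraph m n) (X : Fin m → Bool) where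

  inX : Fin n → ℕ
  inX b = card (λ a → X a ∧ F a b)

  outX : Fin n → ℕ
  outX b = card (λ a → not (X a) ∧ E a b)

  edge-split : F ⊆ᴱ E → ∀ a b →
    indicator (F a b) ≤ indicator (X a ∧ F a b) + indicator (not (X a) ∧ E a b)
  edge-split F⊆E a b with X a | F a b in ab∈F
  ... | true  | true  = s≤s z≤n
  ... | true  | false = z≤n
  ... | false | false = z≤n
  ... | false | true rewrite F⊆E a b ab∈F = s≤s z≤n

  degB-split : F ⊆ᴱ E → ∀ b → degB F b ≤ inX b + outX b
  degB-split F⊆E b = begin
    degB F b                                           ≡⟨ length-filterᵇ (λ a → F a b) (allFin m) ⟩
    sum (map (λ a → indicator (F a b)) (allFin m))     ≤⟨ sum-mono _ _ (λ a → edge-split F⊆E a b) (allFin m) ⟩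
    sum (map (λ a → χX a + χout a) (allFin m))         ≡⟨ sum-+ χX χout (allFin m) ⟩
    sum (map χX (allFin m)) + sum (map χout (allFin m))
      ≡⟨ sym (cong₂ _+_ (length-filterᵇ (λ a → X a ∧ F a b) (allFin m))
                        (length-filterᵇ (λ a → not (X a) ∧ E a b) (allFin m))) ⟩
    inX b + outX b                                     ∎
    where
    open ≤-Reasoning
    χX χout : Fin m → ℕ
    χX a = indicator (X a ∧ F a b)
    χout a = indicator (not (X a) ∧ E a b)

  inX-total : sum (map inX (allFin n)) ≡ sum (map (degA F) (elems X))
  inX-total = begin
    sum (map inX (allFin n))
      ≡⟨ sum-cong inX _ (λ b → length-filterᵇ (λ a → X a ∧ F a b) (allFin m)) (allFin n) ⟩
    sum (map (λ b → sum (map (λ a → χ a b) (allFin m))) (allFin n))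
      ≡⟨ sym (sum-swap χ (allFin m) (allFin n)) ⟩
    sum (map (λ a → sum (map (χ a) (allFin n))) (allFin m))
      ≡⟨ sum-cong _ _ row-sum (allFin m) ⟩
    sum (map (λ a → if X a then degA F a else 0) (allFin m))
      ≡⟨ sym (sum-filterᵇ (degA F) X (allFin m)) ⟩
    sum (map (degA F) (elems X)) ∎
    where
    open ≡-Reasoning
    χ : Fin m → Fin n → ℕ
    χ a b = indicator (X a ∧ F a b)
    row-sum : ∀ a → sum (map (χ a) (allFin n)) ≡ (if X a then degA F a else 0)
    row-sum a with X a
    ... | true  = sym (length-filterᵇ (F a) (allFin n))
    ... | false = sum-zero (allFin n)

  need-bound : (g : Fin n → ℕ) → F ⊆ᴱ E → (Y : Fin n → Bool) → IsQuasiMatching g F Y →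
    gSum g Y ≤ crossEdges E X Y + sum (map (degA F) (elems X))
  need-bound g F⊆E Y covered = begin
    sum (map g (elems Y))
      ≤⟨ sum-filterᵇ-mono g _ Y (λ b b∈Y → ≤-trans (covered b b∈Y) (degB-split F⊆E b)) (allFin n) ⟩
    sum (map (λ b → inX b + outX b) (elems Y))    ≡⟨ sum-+ inX outX (elems Y) ⟩
    sum (map inX (elems Y)) + crossEdges E X Y    ≡⟨ +-comm _ (crossEdges E X Y) ⟩
    crossEdges E X Y + sum (map inX (elems Y))    ≤⟨ +-monoʳ-≤ (crossEdges E X Y) (sum-filterᵇ-≤ inX Y (allFin n)) ⟩
    crossEdges E X Y + sum (map inX (allFin n))   ≡⟨ cong (crossEdges E X Y +_) inX-total ⟩
    crossEdges E X Y + sum (map (degA F) (elems X)) ∎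
    where open ≤-Reasoning

Nonincreasing : List ℕ → Set
Nonincreasing = AllPairs (λ x y → y ≤ x)

AllPairs-reverse : {A : Set} {R : A → A → Set} {xs : List A} →
  AllPairs R xs → AllPairs (λ x y → R y x) (reverse xs)
AllPairs-reverse {xs = []} [] = []
AllPairs-reverse {xs = x ∷ xs} (Rx ∷ Rxs) rewrite unfold-reverse x xs =
  AllPairs.++⁺ (AllPairs-reverse Rxs) ([] ∷ [])
    (All-map (_∷ []) (All-resp-↭ (↭-sym (↭-reverse xs)) Rx))

reverse-sort-nonincreasing : (ws : List ℕ) → Nonincreasing (reverse (sort ws))
reverse-sort-nonincreasing ws = AllPairs-reverse (Linked⇒AllPairs ≤-trans (sort-↗ ws))

reverse-sort-↭ : (ws : List ℕ) → reverse (sort ws) ↭ ws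
reverse-sort-↭ ws = ↭-trans (↭-reverse (sort ws)) (sort-↭ ws)

sum-≤-length* : {c : ℕ} (s : List ℕ) → All (_≤ c) s → sum s ≤ length s * c
sum-≤-length* [] [] = z≤n
sum-≤-length* (x ∷ s) (x≤c ∷ s≤c) = +-mono-≤ x≤c (sum-≤-length* s s≤c)

small-head : {x b : ℕ} (s : List ℕ) → Nonincreasing (x ∷ s) →
  length (x ∷ s) * x < b → b ≤ sum (x ∷ s) → ⊥
small-head {x} s (s≤x ∷ _) small large =
  <-irrefl refl (<-≤-trans small (≤-trans large (sum-≤-length* (x ∷ s) (≤-refl ∷ s≤x))))

dominates-target : ∀ d r kr (s : List ℕ) → Nonincreasing s → length s ≡ r + kr →
  d * (r + kr) + r ≤ sum s → Lex-≤ _≡_ _≤_ (targetSeq d r kr) s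
dominates-target d zero zero [] _ _ _ = base tt
dominates-target d zero zero (x ∷ s) _ () _
dominates-target d (suc r) kr [] _ () _
dominates-target d zero (suc kr) [] _ () _
dominates-target d (suc r) kr (x ∷ s) desc@(_ ∷ desc-s) len large with <-cmp (suc d) x
... | tri< d+1<x _ _ = this (<⇒≤ d+1<x , <⇒≢ d+1<x)
... | tri≈ _ refl _  = next refl (dominates-target d r kr s desc-s (suc-injective len)
                         (+-cancelˡ-≤ (suc d) _ _ (≤-trans (≤-reflexive (sym (peel d r kr))) large)))
  where
  peel : ∀ d r kr → d * (suc r + kr) + suc r ≡ suc d + (d * (r + kr) + r)
  peel = solve-∀
... | tri> _ _ (s≤s x≤d) = ⊥-elim (small-head s desc small large)
  where
  -- every entry is at most d, but the sum exceeds d per entry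
  small : length (x ∷ s) * x < d * (suc r + kr) + suc r
  small = begin-strict
    length (x ∷ s) * x  ≤⟨ *-monoʳ-≤ (length (x ∷ s)) x≤d ⟩
    length (x ∷ s) * d  ≡⟨ cong (_* d) len ⟩
    (suc r + kr) * d    ≡⟨ *-comm (suc r + kr) d ⟩
    d * (suc r + kr)    <⟨ m<m+n _ (s≤s z≤n) ⟩
    d * (suc r + kr) + suc r ∎
    where open ≤-Reasoning
dominates-target d zero (suc kr) (x ∷ s) desc@(_ ∷ desc-s) len large with <-cmp d x
... | tri< d<x _ _ = this (<⇒≤ d<x , <⇒≢ d<x)
... | tri≈ _ refl _ = next refl (dominates-target d zero kr s desc-s (suc-injective len)
                        (+-cancelˡ-≤ d _ _ (≤-trans (≤-reflexive (sym (peel d kr))) large)))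
  where
  peel : ∀ d kr → d * suc kr + 0 ≡ d + (d * kr + 0)
  peel = solve-∀
... | tri> _ _ x<d = ⊥-elim (small-head s desc small large)
  where
  -- every entry is below d, so the sum falls short of d per entry
  small : length (x ∷ s) * x < d * suc kr + 0
  small = begin-strict
    length (x ∷ s) * x  ≡⟨ cong (_* x) len ⟩
    suc kr * x          <⟨ *-monoʳ-< (suc kr) x<d ⟩
    suc kr * d          ≡⟨ *-comm (suc kr) d ⟩
    d * suc kr          ≡⟨ sym (+-identityʳ _) ⟩
    d * suc kr + 0      ∎
    where open ≤-Reasoning

lemma2p9 : (m n : ℕ) (E F : BipGraph m n) (g : Fin n → ℕ)
    → F ⊆ᴱ E
    → IsQuasiMatching g F (λ _ → true)
    → (X : Fin m → Bool) (k : ℕ) → card X ≡ k → 1 ≤ k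
    → (d r : ℕ) → r < k
    → gSum g (nbhd E X) ≡ crossEdges E X (nbhd E X) + d * k + r
    → Lex-≤ _≡_ _≤_ (targetSeq d r (k ∸ r)) (degSeq F X)
lemma2p9 m n E F g F⊆E covered X k |X|≡k _ d r r<k need =
  dominates-target d r (k ∸ r) (degSeq F X)
    (reverse-sort-nonincreasing degrees) length-degSeq sum-degSeq
  where
  degrees : List ℕ
  degrees = map (degA F) (elems X)
  Y : Fin n → Bool
  Y = nbhd E X
  t : ℕ
  t = crossEdges E X Y
  k≡r+[k∸r] : k ≡ r + (k ∸ r)
  k≡r+[k∸r] = sym (m+[n∸m]≡n (<⇒≤ r<k))
  length-degSeq : length (degSeq F X) ≡ r + (k ∸ r)
  length-degSeq = trans (↭-length (reverse-sort-↭ degrees))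
    (trans (length-map (degA F) (elems X)) (trans |X|≡k k≡r+[k∸r]))
  -- g(Y) = t + dk + r and g(Y) ≤ t + Σ_{x ∈ X} d_F(x)
  degree-sum : d * k + r ≤ sum degrees
  degree-sum = +-cancelˡ-≤ t _ _ (begin
    t + (d * k + r)  ≡⟨ sym (+-assoc t (d * k) r) ⟩
    t + d * k + r    ≡⟨ sym need ⟩
    gSum g Y         ≤⟨ DoubleCounting.need-bound E F X g F⊆E Y (λ b _ → covered b refl) ⟩
    t + sum degrees  ∎)
    where open ≤-Reasoning
  sum-degSeq : d * (r + (k ∸ r)) + r ≤ sum (degSeq F X)
  sum-degSeq rewrite sym k≡r+[k∸r] | sum-↭ (reverse-sort-↭ degrees) = degree-sum
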